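{- Let $G=(V,E,O,Pr)$ be a parity game, $J$ a safe justification for $G$, and $v\in V$, $dj$ such that $\mathrm{Justify}(J,v,dj)$ is executable. Let $J'=\mathrm{Justify}(J,v,dj)$. Then $s(J')>s(J)$ in the lexicographic order on justification sizes.
   Context: A parity game is $G=(V,E,O,Pr)$ with finite node set $V$, moves $E\subseteq V\times V$ (every node has an outgoing edge), owner $O:V\to\{0,1\}$ and priority $Pr:V\to\mathbb{N}$ with range contained in $\{1,\dots,n\}$; $\bar\alpha=1-\alpha$. A play of $G$ is an infinite path along $E$, won by player $(m\bmod 2)$ where $m$ is the highest priority occurring infinitely often. A direct justification for $\alpha$ to win $v$: one outgoing edge of $v$ if $O(v)=\alpha$, all outgoing edges of $v$ if $O(v)=\bar\alpha$; it wins $v$ for $\alpha$ under $H:V\to\{0,1\}$ if $H(w)=\alpha$ for all its edges $(v,w)$. A justification is $J=(V,D,H)$ with $D\subseteq E$, $H:V\to\{0,1\}$; $v$ is justified if it has outgoing edges in $D$, unjustified otherwise. $J$ is weakly winning if each justified node's set of outgoing $D$-edges is a direct justification winning it for $H(v)$ under $H$; $J$ is winning if moreover every infinite path $v_1,v_2,\dots$ in $(V,D)$ is won by $H(v_1)$. Let $\downarrow v$ be the set of nodes from which $v$ is reachable in $(V,D)$ (including $v$). The justification level $jl_J(v)$ is the minimum priority of unjustified nodes reachable from $v$ in $(V,D)$ (including $v$), or $+\infty$ if none; for $dj=\{(v,w_1),\dots,(v,w_k)\}$, $jl_J(dj)=\min_i jl_J(w_i)$. The default hypothesis is $H_d(v)=Pr(v)\bmod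 2$. $J$ is safe if (i) $J$ is winning, (ii) $H(v)=H_d(v)$ for all unjustified $v$, (iii) $jl_J(v)\ge Pr(v)$ for all $v$. $J[v:dj,\alpha]$ replaces the outgoing $D$-edges of $v$ by $dj$ and sets $H(v):=\alpha$; $J[w:\emptyset,H_d(w)\mid w\in S]$ removes all outgoing $D$-edges of each $w\in S$ and sets $H(w):=H_d(w)$; modifications apply left to right. $\mathrm{Justify}(J,v,dj)$ is executable if: (1) $J$ is safe and there is a player $\alpha$ such that $dj$ is a direct justification winning $v$ for $\alpha$ under $H$; (2) if $v$ is unjustified then $jl_J(dj)\ge jl_J(v)$, if $v$ is justified then $jl_J(dj)>jl_J(v)$. Then $\mathrm{Justify}(J,v,dj)=J[v:dj,\alpha]$ if $H(v)=\alpha$, and $=J[w:\emptyset,H_d(w)\mid w\in\downarrow v][v:dj,\alpha]$ if $H(v)=\bar\alpha$. The size of a justification $J$ is the tuple $s(J)=(s_{+\infty}(J),s_n(J),\dots,s_1(J))$ where $s_i(J)$ is the number of justified nodes $v$ with $jl_J(v)=i$. Sizes are compared lexicographically: $s(J)>s(J')$ iff, for the highest index $i$ (with $+\infty$ highest) at which $s_i(J)\ne s_i(J')$, we have $s_i(J)>s_i(J')$. -}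

module Defs where

open import Data.Nat using (ℕ; zero; suc; _≤_; _<_; _%_; _≡ᵇ_; _<ᵇ_)
open import Data.Fin using (Fin; _≟_)
open import Data.Bool using (Bool; true; false; _∧_; _∨_; not; if_then_else_)
open import Data.List using (List; []; _∷_; map; foldr; downFrom; allFin)
open import Data.Bool.ListAction using (any)
open import Data.List.Relation.Binary.Lex.Strict using (Lex-<)
open import Data.Product using (Σ; ∃-syntax; _×_)
open import Data.Sum using (_⊎_)
open import Relation.Nullary using (¬_)
open import Relation.Nullary.Decidable using (⌊_⌋)
open import Relation.Binary.PropositionalEquality using (_≡_)

data Player : Set where
  P0 P1 : Player

opp : Player → Player
opp P0 = P1
opp P1 = P0

_==P_ : Player → Player → Bool
P0 ==P P0 = true
P1 ==P P1 = true
_  ==P _  = false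

parity : ℕ → Player
parity m = if m % 2 ≡ᵇ 0 then P0 else P1

data ℕ∞ : Set where
  fin : ℕ → ℕ∞
  ∞   : ℕ∞

min∞ : ℕ∞ → ℕ∞ → ℕ∞
min∞ (fin a) (fin b) = if a <ᵇ b then fin a else fin b
min∞ (fin a) ∞       = fin a
min∞ ∞       y       = y

_==∞_ : ℕ∞ → ℕ∞ → Bool
fin a ==∞ fin b = a ≡ᵇ b
∞     ==∞ ∞     = true
_     ==∞ _     = false

data _≤∞_ : ℕ∞ → ℕ∞ → Set where
  fin≤fin : ∀ {a b} → a ≤ b → fin a ≤∞ fin b
  _≤∞top  : ∀ x → x ≤∞ ∞

data _<∞_ : ℕ∞ → ℕ∞ → Set where
  fin<fin : ∀ {a b} → a < b → fin a <∞ fin b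
  fin<∞   : ∀ {a} → fin a <∞ ∞

record ParityGame : Set where
  field
    N       : ℕ
    n       : ℕ
    E       : Fin N → Fin N → Bool
    O       : Fin N → Player
    Pr      : Fin N → ℕ
    total   : ∀ v → ∃[ w ] E v w ≡ true
    prRange : ∀ v → (1 ≤ Pr v) × (Pr v ≤ n)

-- A justification (V, D, H); D is a Boolean edge relation.
-- (The requirement D ⊆ E is the predicate IsJustification below.)
record Justification (N : ℕ) : Set where
  field
    D : Fin N → Fin N → Bool
    H : Fin N → Player

module Game (G : ParityGame) where
  open ParityGame G public
  open Justification public

  V : Set
  V = Fin N

  J : Set
  J = Justification N

  nodes : List V
  nodes = allFin N

  anyV : (V → Bool) → Bool
  anyV p = any p nodes

  _=V_ : V → V → Bool
  u =V w = ⌊ u ≟ w ⌋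

  IsJustification : J → Set
  IsJustification Jt = ∀ u w → D Jt u w ≡ true → E u w ≡ true

  Hd : V → Player
  Hd v = parity (Pr v)

  -- a direct justification is represented by the set of its targets
  -- (a Boolean predicate on V): dj = {(v,w) | dj w ≡ true}
  DirectJust : Player → V → (V → Bool) → Set
  DirectJust α v dj =
      (O v ≡ α × ∃[ w ] (E v w ≡ true × (∀ u → dj u ≡ (u =V w))))
    ⊎ (O v ≡ opp α × (∀ u → dj u ≡ E v u))

  WinsUnder : (V → Player) → Player → (V → Bool) → Set
  WinsUnder H' α dj = ∀ w → dj w ≡ true → H' w ≡ α

  justifiedᵇ : J → V → Bool
  justifiedᵇ Jt v = anyV (D Jt v)

  Justified : J → V → Set
  Justified Jt v = justifiedᵇ Jt v ≡ true

  WeaklyWinning : J → Set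
  WeaklyWinning Jt = ∀ v → Justified Jt v →
    DirectJust (H Jt v) v (D Jt v) × WinsUnder (H Jt) (H Jt v) (D Jt v)

  WonBy : Player → (ℕ → V) → Set
  WonBy α p = ∃[ m ] (parity m ≡ α
    × (∀ i → ∃[ j ] (i ≤ j × Pr (p j) ≡ m))
    × ∃[ k ] (∀ j → k ≤ j → Pr (p j) ≤ m))

  Winning : J → Set
  Winning Jt = WeaklyWinning Jt
    × (∀ (p : ℕ → V) → (∀ i → D Jt (p i) (p (suc i)) ≡ true) → WonBy (H Jt (p 0)) p)

  reachWithin : J → ℕ → V → V → Bool
  reachWithin Jt zero    u w = u =V w
  reachWithin Jt (suc k) u w = (u =V w) ∨ anyV (λ x → D Jt u x ∧ reachWithin Jt k x w)

  -- w is reachable from u in (V, D) (a path never needs more than N edges)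
  reaches : J → V → V → Bool
  reaches Jt u w = reachWithin Jt N u w

  jl : J → V → ℕ∞
  jl Jt v = foldr (λ w acc → if reaches Jt v w ∧ not (justifiedᵇ Jt w)
                             then min∞ (fin (Pr w)) acc else acc) ∞ nodes

  jlDJ : J → (V → Bool) → ℕ∞
  jlDJ Jt dj = foldr (λ w acc → if dj w then min∞ (jl Jt w) acc else acc) ∞ nodes

  Safe : J → Set
  Safe Jt = Winning Jt
    × (∀ v → ¬ Justified Jt v → H Jt v ≡ Hd v)
    × (∀ v → fin (Pr v) ≤∞ jl Jt v)

  setNode : J → V → (V → Bool) → Player → J
  setNode Jt v dj α = record
    { D = λ u w → if u =V v then dj w else D Jt u w
    ; H = λ u → if u =V v then α else H Jt u }

  resetAbove : J → V → J
  resetAbove Jt v = record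
    { D = λ u w → if reaches Jt u v then false else D Jt u w
    ; H = λ u → if reaches Jt u v then Hd u else H Jt u }

  Executable : J → V → (V → Bool) → Player → Set
  Executable Jt v dj α = Safe Jt
    × DirectJust α v dj × WinsUnder (H Jt) α dj
    × (¬ Justified Jt v → jl Jt v ≤∞ jlDJ Jt dj)
    × (Justified Jt v → jl Jt v <∞ jlDJ Jt dj)

  Justify : J → V → (V → Bool) → Player → J
  Justify Jt v dj α =
    if H Jt v ==P α then setNode Jt v dj α
    else setNode (resetAbove Jt v) v dj α

  count : J → ℕ∞ → ℕ
  count Jt i = foldr (λ v acc → if justifiedᵇ Jt v ∧ (jl Jt v ==∞ i)
                               then suc acc else acc) 0 nodes

  size : J → List ℕ
  size Jt = count Jt ∞ ∷ map (λ k → count Jt (fin (suc k))) (downFrom n)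

  _<size_ : List ℕ → List ℕ → Set
  _<size_ = Lex-< _≡_ _<_

-- Let J' = Justify(J, v, dj) and t = jl_{J'}(v).  Every unjustified node below v in J' lies
-- below a target of dj, so t ≥ jl_J(dj) ≥ jl_J(v).  Only the nodes of ↓v change: outside ↓v
-- both D and jl are untouched.  Inside ↓v no node of J' lies strictly above level t, and every
-- node of ↓v justified in J at a level ≥ t keeps its level, while v is newly counted at level t.
-- Hence s_l(J') = s_l(J) for l > t and s_t(J') > s_t(J).
-- When H(v) = ᾱ the nodes of ↓v are reset, which needs t > jl_J(v).  For justified v this is
-- executability; for unjustified v safety gives jl_J(v) = Pr(v), and jl_J(dj) = Pr(v) would give
-- an unjustified w of priority Pr(v) below a target of dj, so H(w) = α by weak winningness,
-- while H(w) = H_d(w) = H_d(v) = H(v) = ᾱ.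
module Submission where

open import Defs
open import Data.Bool using (Bool; true; false; _∧_; _∨_; not; if_then_else_)
open import Data.Bool.Properties using (T-≡; ∧-conicalˡ; ∧-conicalʳ; ∨-zeroʳ)
  renaming (_≟_ to _≟ᵇ_)
open import Data.Bool.ListAction using (any; or)
open import Data.Fin using (Fin; _≟_) renaming (zero to fzero; suc to fsuc)
open import Data.Fin.Properties using (injective⇒≤)
open import Data.List using (List; []; _∷_; map; foldr; downFrom; length; lookup)
open import Data.List.Properties using (map-cong)
open import Data.List.Membership.Propositional using (_∈_; lose)
open import Data.List.Membership.Propositional.Properties using (∈-allFin; ∈-lookup)
open import Data.List.Relation.Binary.Lex.Core using (this; next)
open import Data.List.Relation.Binary.Lex.Strict using (Lex-<)
import Data.List.Relation.Unary.All as All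
open import Data.List.Relation.Unary.All.Properties using (¬Any⇒All¬)
open import Data.List.Relation.Unary.AllPairs using ([]; _∷_)
open import Data.List.Relation.Unary.Any using (here; there; satisfied)
open import Data.List.Relation.Unary.Any.Properties using (any⁺; any⁻)
open import Data.List.Relation.Unary.Unique.Propositional using (Unique)
open import Data.Nat using (ℕ; zero; suc; _≤_; _<_; _<ᵇ_; z≤n; s≤s)
open import Data.Nat.Properties
  using (≤-refl; ≤-trans; ≤-antisym; <⇒≤; <-irrefl; <-≤-trans; ≮⇒≥; ≤∧≢⇒<; m≤n⇒m≤1+n;
         m<n⇒m<1+n; m<1+n⇒m<n∨m≡n; <ᵇ⇒<; <⇒<ᵇ; ≡ᵇ⇒≡; ≡⇒≡ᵇ)
open import Data.Product using (Σ-syntax; ∃-syntax; _×_; _,_; proj₁; proj₂)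
open import Data.Sum using (_⊎_; inj₁; inj₂)
open import Function using (_∘_; case_of_; Equivalence)
open import Relation.Nullary using (¬_; Dec; yes; no; contradiction)
open import Relation.Binary.PropositionalEquality
  using (_≡_; _≢_; refl; sym; trans; cong; cong₂; subst; module ≡-Reasoning)
open import Relation.Binary.Construct.Closure.ReflexiveTransitive using (Star; ε; _◅_; _◅◅_)

open Equivalence using (to; from)

≤∞-refl : ∀ {x} → x ≤∞ x
≤∞-refl {fin a} = fin≤fin ≤-refl
≤∞-refl {∞}     = ∞ ≤∞top

≤∞-reflexive : ∀ {x y} → x ≡ y → x ≤∞ y
≤∞-reflexive refl = ≤∞-refl

≤∞-trans : ∀ {x y z} → x ≤∞ y → y ≤∞ z → x ≤∞ z
≤∞-trans     (fin≤fin p) (fin≤fin q) = fin≤fin (≤-trans p q)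
≤∞-trans {x} _           (_ ≤∞top)   = x ≤∞top

≤∞-antisym : ∀ {x y} → x ≤∞ y → y ≤∞ x → x ≡ y
≤∞-antisym (fin≤fin p) (fin≤fin q) = cong fin (≤-antisym p q)
≤∞-antisym (_ ≤∞top)   (_ ≤∞top)   = refl

<∞⇒≤∞ : ∀ {x y} → x <∞ y → x ≤∞ y
<∞⇒≤∞     (fin<fin p) = fin≤fin (<⇒≤ p)
<∞⇒≤∞ {x} fin<∞       = x ≤∞top

<∞-≤∞-trans : ∀ {x y z} → x <∞ y → y ≤∞ z → x <∞ z
<∞-≤∞-trans (fin<fin p) (fin≤fin q) = fin<fin (<-≤-trans p q)
<∞-≤∞-trans (fin<fin p) (_ ≤∞top)   = fin<∞
<∞-≤∞-trans fin<∞       (_ ≤∞top)   = fin<∞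

<∞-irrefl : ∀ {x} → ¬ x <∞ x
<∞-irrefl (fin<fin p) = <-irrefl refl p

<∞⇒≱∞ : ∀ {x y} → x <∞ y → ¬ y ≤∞ x
<∞⇒≱∞ x<y y≤x = <∞-irrefl (<∞-≤∞-trans x<y y≤x)

min∞-fin : ∀ a b → (min∞ (fin a) (fin b) ≡ fin a × a ≤ b) ⊎ (min∞ (fin a) (fin b) ≡ fin b × b ≤ a)
min∞-fin a b with a <ᵇ b in eq
... | true  = inj₁ (refl , <⇒≤ (<ᵇ⇒< a b (from T-≡ eq)))
... | false = inj₂ (refl , ≮⇒≥ (λ a<b → case trans (sym (to T-≡ (<⇒<ᵇ a<b))) eq of λ ()))

min∞-≤ˡ : ∀ x y → min∞ x y ≤∞ x
min∞-≤ˡ (fin a) (fin b) with min∞-fin a b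
... | inj₁ (e , _)   rewrite e = ≤∞-refl
... | inj₂ (e , b≤a) rewrite e = fin≤fin b≤a
min∞-≤ˡ (fin a) ∞ = ≤∞-refl
min∞-≤ˡ ∞       y = y ≤∞top

min∞-≤ʳ : ∀ x y → min∞ x y ≤∞ y
min∞-≤ʳ (fin a) (fin b) with min∞-fin a b
... | inj₁ (e , a≤b) rewrite e = fin≤fin a≤b
... | inj₂ (e , _)   rewrite e = ≤∞-refl
min∞-≤ʳ (fin a) ∞ = _ ≤∞top
min∞-≤ʳ ∞       y = ≤∞-refl

min∞-glb : ∀ {z} x y → z ≤∞ x → z ≤∞ y → z ≤∞ min∞ x y
min∞-glb (fin a) (fin b) p q with min∞-fin a b
... | inj₁ (e , _) rewrite e = p
... | inj₂ (e , _) rewrite e = q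
min∞-glb (fin a) ∞ p q = p
min∞-glb ∞       y p q = q

min∞-sel : ∀ x y → min∞ x y ≡ x ⊎ min∞ x y ≡ y
min∞-sel (fin a) (fin b) with min∞-fin a b
... | inj₁ (e , _) = inj₁ e
... | inj₂ (e , _) = inj₂ e
min∞-sel (fin a) ∞ = inj₁ refl
min∞-sel ∞       y = inj₂ refl

==∞-refl : ∀ x → (x ==∞ x) ≡ true
==∞-refl (fin a) = to T-≡ (≡⇒≡ᵇ a a refl)
==∞-refl ∞       = refl

==∞⇒≡ : ∀ {x y} → (x ==∞ y) ≡ true → x ≡ y
==∞⇒≡ {fin a} {fin b} e = cong fin (≡ᵇ⇒≡ a b (from T-≡ e))
==∞⇒≡ {∞}     {∞}     e = refl

==P⇒≢ : ∀ {a b} → (a ==P b) ≡ false → a ≢ b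
==P⇒≢ {P0} () refl
==P⇒≢ {P1} () refl

≢true⇒not : ∀ {b} → b ≢ true → not b ≡ true
≢true⇒not {false} _  = refl
≢true⇒not {true}  ne = contradiction refl ne

not⇒≢true : ∀ {b} → not b ≡ true → b ≢ true
not⇒≢true {false} _ ()

module _ {A : Set} where

  any-witness : ∀ (p : A → Bool) xs → any p xs ≡ true → ∃[ x ] p x ≡ true
  any-witness p xs e with satisfied (any⁻ p xs (from T-≡ e))
  ... | x , px = x , to T-≡ px

  any-intro : ∀ (p : A → Bool) {xs x} → x ∈ xs → p x ≡ true → any p xs ≡ true
  any-intro p x∈xs px = to T-≡ (any⁺ p (lose x∈xs (from T-≡ px)))

  any-cong : ∀ {p q : A → Bool} → (∀ x → p x ≡ q x) → ∀ xs → any p xs ≡ any q xs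
  any-cong p≗q xs = cong or (map-cong p≗q xs)

  Unique⇒lookup-injective : ∀ {xs : List A} → Unique xs → ∀ {i j} → lookup xs i ≡ lookup xs j → i ≡ j
  Unique⇒lookup-injective (_ ∷ _)       {fzero}  {fzero}  _ = refl
  Unique⇒lookup-injective (x∉ ∷ _)      {fzero}  {fsuc j} e = contradiction e (All.lookup x∉ (∈-lookup j))
  Unique⇒lookup-injective (x∉ ∷ _)      {fsuc i} {fzero}  e = contradiction (sym e) (All.lookup x∉ (∈-lookup i))
  Unique⇒lookup-injective (_ ∷ unique)  {fsuc i} {fsuc j} e = cong fsuc (Unique⇒lookup-injective unique e)

  -- jl and jlDJ are instances of minWhere, and count of countWhere, up to β-reduction.
  minWhere : (A → Bool) → (A → ℕ∞) → List A → ℕ∞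
  minWhere c f = foldr (λ w acc → if c w then min∞ (f w) acc else acc) ∞

  minWhere-glb : ∀ c f xs {z} → (∀ {w} → w ∈ xs → c w ≡ true → z ≤∞ f w) → z ≤∞ minWhere c f xs
  minWhere-glb c f []       {z} _ = z ≤∞top
  minWhere-glb c f (y ∷ xs) h with c y in cy
  ... | true  = min∞-glb (f y) _ (h (here refl) cy) (minWhere-glb c f xs (h ∘ there))
  ... | false = minWhere-glb c f xs (h ∘ there)

  minWhere-≤ : ∀ c f xs {w} → w ∈ xs → c w ≡ true → minWhere c f xs ≤∞ f w
  minWhere-≤ c f (y ∷ xs) (here refl) cw rewrite cw = min∞-≤ˡ (f y) _
  minWhere-≤ c f (y ∷ xs) (there w∈) cw with c y
  ... | true  = ≤∞-trans (min∞-≤ʳ (f y) _) (minWhere-≤ c f xs w∈ cw)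
  ... | false = minWhere-≤ c f xs w∈ cw

  minWhere-attained : ∀ c f xs {p} → minWhere c f xs ≡ fin p → ∃[ w ] (c w ≡ true × f w ≡ fin p)
  minWhere-attained c f (y ∷ xs) e with c y in cy
  ... | false = minWhere-attained c f xs e
  ... | true with min∞-sel (f y) (minWhere c f xs)
  ...   | inj₁ e′ = y , cy , trans (sym e′) e
  ...   | inj₂ e′ = minWhere-attained c f xs (trans (sym e′) e)

  countWhere : (A → Bool) → List A → ℕ
  countWhere c = foldr (λ w acc → if c w then suc acc else acc) 0

  countWhere-mono : ∀ c c′ xs → (∀ {w} → c w ≡ true → c′ w ≡ true) → countWhere c xs ≤ countWhere c′ xs
  countWhere-mono c c′ []       _ = z≤n
  countWhere-mono c c′ (y ∷ xs) h with c y in cy | c′ y in c′y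
  ... | true  | true  = s≤s (countWhere-mono c c′ xs h)
  ... | true  | false = case trans (sym (h cy)) c′y of λ ()
  ... | false | true  = m≤n⇒m≤1+n (countWhere-mono c c′ xs h)
  ... | false | false = countWhere-mono c c′ xs h

  countWhere-strict : ∀ c c′ xs {w} → w ∈ xs → c w ≢ true → c′ w ≡ true →
    (∀ {w} → c w ≡ true → c′ w ≡ true) → countWhere c xs < countWhere c′ xs
  countWhere-strict c c′ (y ∷ xs) {w} (here refl) ¬cw c′w h with c w
  ... | true  = contradiction refl ¬cw
  ... | false rewrite c′w = s≤s (countWhere-mono c c′ xs h)
  countWhere-strict c c′ (y ∷ xs) (there w∈) ¬cw c′w h with c y in cy | c′ y in c′y
  ... | true  | true  = s≤s (countWhere-strict c c′ xs w∈ ¬cw c′w h)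
  ... | true  | false = case trans (sym (h cy)) c′y of λ ()
  ... | false | true  = m<n⇒m<1+n (countWhere-strict c c′ xs w∈ ¬cw c′w h)
  ... | false | false = countWhere-strict c c′ xs w∈ ¬cw c′w h

-- size Jt is profile n (count Jt) by definition.
profile : ℕ → (ℕ∞ → ℕ) → List ℕ
profile n c = c ∞ ∷ map (λ k → c (fin (suc k))) (downFrom n)

data InProfile (n : ℕ) : ℕ∞ → Set where
  ∞∈   : InProfile n ∞
  fin∈ : ∀ {p} → 1 ≤ p → p ≤ n → InProfile n (fin p)

profile-< : ∀ n (c c′ : ℕ∞ → ℕ) {t} → InProfile n t → c t < c′ t → (∀ l → t <∞ l → c l ≡ c′ l) →
  Lex-< _≡_ _<_ (profile n c) (profile n c′)
profile-< n c c′ ∞∈                    ct<c′t _     = this ct<c′t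
profile-< n c c′ (fin∈ {suc p} _ p<n) ct<c′t above = next (above ∞ fin<∞) (levels-< n p<n)
  where
  levels-< : ∀ k → p < k →
    Lex-< _≡_ _<_ (map (λ k → c (fin (suc k))) (downFrom k)) (map (λ k → c′ (fin (suc k))) (downFrom k))
  levels-< (suc k) p<1+k with m<1+n⇒m<n∨m≡n p<1+k
  ... | inj₂ refl = this ct<c′t
  ... | inj₁ p<k  = next (above (fin (suc k)) (fin<fin (s≤s p<k))) (levels-< k p<k)

module _ (G : ParityGame) where
  open Game G
  open import Data.List.Membership.DecPropositional {A = V} _≟_ using (_∈?_)

  Edge : (V → V → Bool) → V → V → Set
  Edge d u w = d u w ≡ true

  Reach : (V → V → Bool) → V → V → Set
  Reach d = Star (Edge d)

  outside-≢ : ∀ {d u v} → ¬ Reach d u v → u ≢ v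
  outside-≢ nr refl = nr ε

  justified? : ∀ Jt u → Dec (Justified Jt u)
  justified? Jt u = justifiedᵇ Jt u ≟ᵇ true

  reachWithin⇒Reach : ∀ Jt k {u w} → reachWithin Jt k u w ≡ true → Reach (D Jt) u w
  reachWithin⇒Reach Jt zero {u} {w} e with u ≟ w
  reachWithin⇒Reach Jt zero e | yes refl = ε
  reachWithin⇒Reach Jt zero () | no _
  reachWithin⇒Reach Jt (suc k) {u} {w} e with u ≟ w
  ... | yes refl = ε
  ... | no _ with any-witness (λ x → D Jt u x ∧ reachWithin Jt k x w) nodes e
  ...   | x , ex = ∧-conicalˡ _ _ ex ◅ reachWithin⇒Reach Jt k (∧-conicalʳ _ _ ex)

  sources : ∀ {d u w} → Reach d u w → List V
  sources             ε       = []
  sources {u = u} (_ ◅ p) = u ∷ sources p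

  Reach⇒reachWithin : ∀ Jt k {u w} (p : Reach (D Jt) u w) → length (sources p) ≤ k →
    reachWithin Jt k u w ≡ true
  Reach⇒reachWithin Jt zero    {u} ε _ with u ≟ u
  ... | yes _ = refl
  ... | no u≢u = contradiction refl u≢u
  Reach⇒reachWithin Jt (suc k) {u} ε _ with u ≟ u
  ... | yes _ = refl
  ... | no u≢u = contradiction refl u≢u
  Reach⇒reachWithin Jt (suc k) {u} {w} (_◅_ {j = x} e p) (s≤s len≤k) =
    trans (cong ((u =V w) ∨_) step) (∨-zeroʳ (u =V w))
    where
    step : any (λ y → D Jt u y ∧ reachWithin Jt k y w) nodes ≡ true
    step = any-intro _ (∈-allFin x) (cong₂ _∧_ e (Reach⇒reachWithin Jt k p len≤k))

  suffix-from : ∀ {d x w u} (p : Reach d x w) → Unique (sources p) → u ∈ sources p →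
    Σ[ q ∈ Reach d u w ] Unique (sources q)
  suffix-from (e ◅ p) unique        (here refl) = e ◅ p , unique
  suffix-from (e ◅ p) (_ ∷ unique) (there u∈)  = suffix-from p unique u∈

  erase-loops : ∀ {d u w} (p : Reach d u w) → Σ[ q ∈ Reach d u w ] Unique (sources q)
  erase-loops ε = ε , []
  erase-loops {u = u} (e ◅ p) with erase-loops p
  ... | q , unique with u ∈? sources q
  ...   | yes u∈ = suffix-from q unique u∈
  ...   | no  u∉ = e ◅ q , ¬Any⇒All¬ (sources q) u∉ ∷ unique

  Reach⇒reaches : ∀ Jt {u w} → Reach (D Jt) u w → reaches Jt u w ≡ true
  Reach⇒reaches Jt p with erase-loops p
  ... | q , unique = Reach⇒reachWithin Jt N q (injective⇒≤ (Unique⇒lookup-injective unique))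

  reaches⇒Reach : ∀ Jt {u w} → reaches Jt u w ≡ true → Reach (D Jt) u w
  reaches⇒Reach Jt = reachWithin⇒Reach Jt N

  Reach? : ∀ Jt u w → Dec (Reach (D Jt) u w)
  Reach? Jt u w with reaches Jt u w in e
  ... | true  = yes (reaches⇒Reach Jt e)
  ... | false = no λ r → case trans (sym (Reach⇒reaches Jt r)) e of λ ()

  unjustified-from : J → V → V → Bool
  unjustified-from Jt u w = reaches Jt u w ∧ not (justifiedᵇ Jt w)

  jl-glb : ∀ Jt u {z} → (∀ {w} → Reach (D Jt) u w → ¬ Justified Jt w → z ≤∞ fin (Pr w)) → z ≤∞ jl Jt u
  jl-glb Jt u h = minWhere-glb (unjustified-from Jt u) (fin ∘ Pr) nodes λ _ c →
    h (reaches⇒Reach Jt (∧-conicalˡ _ _ c)) (not⇒≢true (∧-conicalʳ _ _ c))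

  jl-≤ : ∀ Jt {u w} → Reach (D Jt) u w → ¬ Justified Jt w → jl Jt u ≤∞ fin (Pr w)
  jl-≤ Jt {u} {w} r nj = minWhere-≤ (unjustified-from Jt u) (fin ∘ Pr) nodes (∈-allFin w)
    (cong₂ _∧_ (Reach⇒reaches Jt r) (≢true⇒not nj))

  jl-attained : ∀ Jt u {p} → jl Jt u ≡ fin p → ∃[ w ] (Reach (D Jt) u w × ¬ Justified Jt w × Pr w ≡ p)
  jl-attained Jt u e with minWhere-attained (unjustified-from Jt u) (fin ∘ Pr) nodes e
  ... | w , c , refl = w , reaches⇒Reach Jt (∧-conicalˡ _ _ c) , not⇒≢true (∧-conicalʳ _ _ c) , refl

  jl-≤-Reach : ∀ Jt {u w} → Reach (D Jt) u w → jl Jt u ≤∞ jl Jt w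
  jl-≤-Reach Jt {w = w} r = jl-glb Jt w λ r′ nj → jl-≤ Jt (r ◅◅ r′) nj

  jl-InProfile : ∀ Jt u → InProfile n (jl Jt u)
  jl-InProfile Jt u with jl Jt u in e
  ... | ∞ = ∞∈
  ... | fin p with jl-attained Jt u e
  ...   | w , _ , _ , refl = fin∈ (proj₁ (prRange w)) (proj₂ (prRange w))

  jlDJ-glb : ∀ Jt dj {z} → (∀ {x} → dj x ≡ true → z ≤∞ jl Jt x) → z ≤∞ jlDJ Jt dj
  jlDJ-glb Jt dj h = minWhere-glb dj (jl Jt) nodes λ _ → h

  jlDJ-≤ : ∀ Jt dj {x} → dj x ≡ true → jlDJ Jt dj ≤∞ jl Jt x
  jlDJ-≤ Jt dj {x} = minWhere-≤ dj (jl Jt) nodes (∈-allFin x)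

  jlDJ-attained : ∀ Jt dj {p} → jlDJ Jt dj ≡ fin p →
    ∃[ x ] ∃[ w ] (dj x ≡ true × Reach (D Jt) x w × ¬ Justified Jt w × Pr w ≡ p)
  jlDJ-attained Jt dj e with minWhere-attained dj (jl Jt) nodes e
  ... | x , dx , ex with jl-attained Jt x ex
  ...   | w , r , nj , refl = x , w , dx , r , nj , refl

  H-along : ∀ {Jt} → WeaklyWinning Jt → ∀ {u w} → Reach (D Jt) u w → H Jt u ≡ H Jt w
  H-along ww ε = refl
  H-along {Jt} ww {u} (_◅_ {j = x} e p) =
    trans (sym (proj₂ (ww u (any-intro (D Jt u) (∈-allFin x) e)) x e)) (H-along ww p)

  DirectJust-target : ∀ {α v dj} → DirectJust α v dj → ∃[ w ] dj w ≡ true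
  DirectJust-target (inj₁ (_ , w , _ , dj≗w)) with w ≟ w | dj≗w w
  ... | yes _   | dw = w , dw
  ... | no  w≢w | _  = contradiction refl w≢w
  DirectJust-target {v = v} (inj₂ (_ , dj≗E)) with total v
  ... | w , e = w , trans (dj≗E w) e

  record SameOutside (Jt J′ : J) (v : V) : Set where
    constructor same-outside
    field same-D : ∀ {u} → ¬ Reach (D Jt) u v → ∀ x → D J′ u x ≡ D Jt u x

  module _ {Jt J′ v} (same : SameOutside Jt J′ v) where
    open SameOutside same

    Reach-outside⁺ : ∀ {u w} → ¬ Reach (D Jt) u v → Reach (D Jt) u w → Reach (D J′) u w
    Reach-outside⁺ nr ε       = ε
    Reach-outside⁺ nr (e ◅ p) = trans (same-D nr _) e ◅ Reach-outside⁺ (nr ∘ (e ◅_)) p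

    Reach-outside⁻ : ∀ {u w} → ¬ Reach (D Jt) u v → Reach (D J′) u w → Reach (D Jt) u w
    Reach-outside⁻ nr ε       = ε
    Reach-outside⁻ nr (e ◅ p) with trans (sym (same-D nr _)) e
    ... | e′ = e′ ◅ Reach-outside⁻ (nr ∘ (e′ ◅_)) p

    justified-outside : ∀ {u} → ¬ Reach (D Jt) u v → justifiedᵇ J′ u ≡ justifiedᵇ Jt u
    justified-outside nr = any-cong (same-D nr) nodes

    jl-outside : ∀ {u} → ¬ Reach (D Jt) u v → jl J′ u ≡ jl Jt u
    jl-outside {u} nr = ≤∞-antisym
      (jl-glb Jt u λ r nj → jl-≤ J′ (Reach-outside⁺ nr r)
        (nj ∘ subst (_≡ true) (justified-outside (nr ∘ (r ◅◅_)))))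
      (jl-glb J′ u λ r nj → let r′ = Reach-outside⁻ nr r in jl-≤ Jt r′
        (nj ∘ subst (_≡ true) (sym (justified-outside (nr ∘ (r′ ◅◅_))))))

  atLevel : J → ℕ∞ → V → Bool
  atLevel K l u = justifiedᵇ K u ∧ (jl K u ==∞ l)

  atLevel⁺ : ∀ K {l u} → Justified K u → jl K u ≡ l → atLevel K l u ≡ true
  atLevel⁺ K {u = u} ju refl rewrite ju = ==∞-refl (jl K u)

  atLevel⁻ : ∀ K {l u} → atLevel K l u ≡ true → Justified K u × jl K u ≡ l
  atLevel⁻ K e = ∧-conicalˡ _ _ e , ==∞⇒≡ (∧-conicalʳ _ _ e)

  size-grows : ∀ Jt J′ v → Justified J′ v →
    (∀ {u} → Justified Jt u → jl J′ v ≤∞ jl Jt u → u ≢ v × Justified J′ u × jl J′ u ≡ jl Jt u) →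
    (∀ {u} → Justified J′ u → jl J′ v <∞ jl J′ u → Justified Jt u × jl Jt u ≡ jl J′ u) →
    size Jt <size size J′
  size-grows Jt J′ v jv keep restore = profile-< n (count Jt) (count J′) (jl-InProfile J′ v) grows same
    where
    t = jl J′ v

    kept : ∀ {l} → t ≤∞ l → ∀ {u} → atLevel Jt l u ≡ true → atLevel J′ l u ≡ true
    kept t≤l e with atLevel⁻ Jt e
    ... | ju , refl with keep ju t≤l
    ...   | _ , ju′ , eq = atLevel⁺ J′ ju′ eq

    restored : ∀ {l} → t <∞ l → ∀ {u} → atLevel J′ l u ≡ true → atLevel Jt l u ≡ true
    restored t<l e with atLevel⁻ J′ e
    ... | ju , refl with restore ju t<l
    ...   | ju′ , eq = atLevel⁺ Jt ju′ eq

    v-fresh : atLevel Jt t v ≢ true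
    v-fresh e with atLevel⁻ Jt e
    ... | ju , eq = proj₁ (keep ju (≤∞-reflexive (sym eq))) refl

    grows : count Jt t < count J′ t
    grows = countWhere-strict (atLevel Jt t) (atLevel J′ t) nodes (∈-allFin v)
              v-fresh (atLevel⁺ J′ jv refl) (kept ≤∞-refl)

    same : ∀ l → t <∞ l → count Jt l ≡ count J′ l
    same l t<l = ≤-antisym (countWhere-mono _ _ nodes (kept (<∞⇒≤∞ t<l)))
                           (countWhere-mono _ _ nodes (restored t<l))

  size-grows-within : ∀ Jt J′ v → SameOutside Jt J′ v → Justified J′ v →
    (∀ {u} → Reach (D Jt) u v → Justified Jt u → jl J′ v ≤∞ jl Jt u →
       u ≢ v × Justified J′ u × jl J′ u ≡ jl Jt u) →
    (∀ {u} → Reach (D Jt) u v → Justified J′ u → ¬ jl J′ v <∞ jl J′ u) →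
    size Jt <size size J′
  size-grows-within Jt J′ v same jv keep-within none-above = size-grows Jt J′ v jv keep restore
    where
    keep : ∀ {u} → Justified Jt u → jl J′ v ≤∞ jl Jt u → u ≢ v × Justified J′ u × jl J′ u ≡ jl Jt u
    keep {u} ju le with Reach? Jt u v
    ... | yes r  = keep-within r ju le
    ... | no  nr = outside-≢ nr , trans (justified-outside same nr) ju , jl-outside same nr

    restore : ∀ {u} → Justified J′ u → jl J′ v <∞ jl J′ u → Justified Jt u × jl Jt u ≡ jl J′ u
    restore {u} ju lt with Reach? Jt u v
    ... | yes r  = contradiction lt (none-above r ju)
    ... | no  nr = trans (sym (justified-outside same nr)) ju , sym (jl-outside same nr)

  module _ (K : J) (v : V) (dj : V → Bool) (α : Player) where

    setNode-D-other : ∀ {u} → u ≢ v → ∀ x → D (setNode K v dj α) u x ≡ D K u x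
    setNode-D-other {u} u≢v x with u ≟ v
    ... | yes u≡v = contradiction u≡v u≢v
    ... | no  _   = refl

    setNode-D-self : ∀ x → D (setNode K v dj α) v x ≡ dj x
    setNode-D-self x with v ≟ v
    ... | yes _   = refl
    ... | no  v≢v = contradiction refl v≢v

    setNode-justified-other : ∀ {u} → u ≢ v → justifiedᵇ (setNode K v dj α) u ≡ justifiedᵇ K u
    setNode-justified-other u≢v = any-cong (setNode-D-other u≢v) nodes

    setNode-justified-self : DirectJust α v dj → Justified (setNode K v dj α) v
    setNode-justified-self djv with DirectJust-target djv
    ... | w , dw = any-intro _ (∈-allFin w) (trans (setNode-D-self w) dw)

    setNode-edge : ∀ {u y} → Edge (D (setNode K v dj α)) u y →
      (u ≡ v × dj y ≡ true) ⊎ (u ≢ v × Edge (D K) u y)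
    setNode-edge {u} {y} e with u ≟ v
    ... | yes u≡v = inj₁ (u≡v , e)
    ... | no  u≢v = inj₂ (u≢v , e)

    setNode-path : ∀ {u w} → Reach (D (setNode K v dj α)) u w →
      w ≡ v ⊎ (u ≢ v × Reach (D K) u w) ⊎ ∃[ x ] (dj x ≡ true × Reach (D K) x w)
    setNode-path {u} ε with u ≟ v
    ... | yes u≡v = inj₁ u≡v
    ... | no  u≢v = inj₂ (inj₁ (u≢v , ε))
    setNode-path (_◅_ {j = y} e p) with setNode-path p | setNode-edge e
    ... | inj₁ w≡v              | _                 = inj₁ w≡v
    ... | inj₂ (inj₂ via)       | _                 = inj₂ (inj₂ via)
    ... | inj₂ (inj₁ (_ , q))   | inj₁ (_ , dy)     = inj₂ (inj₂ (y , dy , q))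
    ... | inj₂ (inj₁ (_ , q))   | inj₂ (u≢v , eK)   = inj₂ (inj₁ (u≢v , eK ◅ q))

    Reach-setNode : ∀ {u} → Reach (D K) u v → Reach (D (setNode K v dj α)) u v
    Reach-setNode ε = ε
    Reach-setNode {u} (_◅_ {j = y} e p) with u ≟ v
    ... | yes refl = ε
    ... | no  u≢v  = trans (setNode-D-other u≢v y) e ◅ Reach-setNode p

    setNode-unjustified : Justified (setNode K v dj α) v →
      ∀ {w} → ¬ Justified (setNode K v dj α) w → ¬ Justified K w
    setNode-unjustified jv {w} nj jK = nj (trans (setNode-justified-other w≢v) jK)
      where
      w≢v : w ≢ v
      w≢v refl = nj jv

    jl-setNode-glb : Justified (setNode K v dj α) v → ∀ {u z} →
      (u ≢ v → z ≤∞ jl K u) → z ≤∞ jlDJ K dj → z ≤∞ jl (setNode K v dj α) u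
    jl-setNode-glb jv {u} {z} z≤u z≤dj = jl-glb _ u bound
      where
      bound : ∀ {w} → Reach (D (setNode K v dj α)) u w → ¬ Justified (setNode K v dj α) w →
        z ≤∞ fin (Pr w)
      bound r nj with setNode-path r
      ... | inj₁ refl                = contradiction jv nj
      ... | inj₂ (inj₁ (u≢v , q))    = ≤∞-trans (z≤u u≢v) (jl-≤ K q (setNode-unjustified jv nj))
      ... | inj₂ (inj₂ (x , dx , q)) =
        ≤∞-trans z≤dj (≤∞-trans (jlDJ-≤ K dj dx) (jl-≤ K q (setNode-unjustified jv nj)))

    jlDJ≤jl-setNode : Justified (setNode K v dj α) v → jlDJ K dj ≤∞ jl (setNode K v dj α) v
    jlDJ≤jl-setNode jv = jl-setNode-glb jv (λ v≢v → contradiction refl v≢v) ≤∞-refl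

  SameOutside-setNode : ∀ {Jt K v dj α} → SameOutside Jt K v → SameOutside Jt (setNode K v dj α) v
  SameOutside-setNode {K = K} {v} {dj} {α} (same-outside same) = same-outside λ nr x →
    trans (setNode-D-other K v dj α (outside-≢ nr) x) (same nr x)

  SameOutside-resetAbove : ∀ Jt v → SameOutside Jt (resetAbove Jt v) v
  SameOutside-resetAbove Jt v = same-outside reset-D
    where
    reset-D : ∀ {u} → ¬ Reach (D Jt) u v → ∀ x → D (resetAbove Jt v) u x ≡ D Jt u x
    reset-D {u} nr x with reaches Jt u v in e
    ... | true  = contradiction (reaches⇒Reach Jt e) nr
    ... | false = refl

  resetAbove-unjustified : ∀ {Jt v u} → Reach (D Jt) u v → ¬ Justified (resetAbove Jt v) u
  resetAbove-unjustified {Jt} {v} {u} r ju with any-witness _ nodes ju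
  ... | x , e = case trans (sym reset) e of λ ()
    where
    reset : D (resetAbove Jt v) u x ≡ false
    reset = cong (λ b → if b then false else D Jt u x) (Reach⇒reaches Jt r)

  setNode-grows : ∀ Jt v dj α → DirectJust α v dj →
    (¬ Justified Jt v → jl Jt v ≤∞ jlDJ Jt dj) → (Justified Jt v → jl Jt v <∞ jlDJ Jt dj) →
    size Jt <size size (setNode Jt v dj α)
  setNode-grows Jt v dj α djv ≤dj <dj =
    size-grows-within Jt J′ v (SameOutside-setNode (same-outside λ _ _ → refl)) jv
      keep-within none-above
    where
    J′ = setNode Jt v dj α
    jv = setNode-justified-self Jt v dj α djv

    keep-within : ∀ {u} → Reach (D Jt) u v → Justified Jt u → jl J′ v ≤∞ jl Jt u →
      u ≢ v × Justified J′ u × jl J′ u ≡ jl Jt u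
    keep-within {u} r ju le with justified? Jt v
    ... | yes jv₀ = contradiction
          (≤∞-trans (jlDJ≤jl-setNode Jt v dj α jv) (≤∞-trans le (jl-≤-Reach Jt r)))
          (<∞⇒≱∞ (<dj jv₀))
    ... | no njv₀ = u≢v , trans (setNode-justified-other Jt v dj α u≢v) ju , ≤∞-antisym
          (≤∞-trans (jl-≤-Reach J′ (Reach-setNode Jt v dj α r)) le)
          (jl-setNode-glb Jt v dj α jv (λ _ → ≤∞-refl) (≤∞-trans (jl-≤-Reach Jt r) (≤dj njv₀)))
      where
      u≢v : u ≢ v
      u≢v refl = njv₀ ju

    none-above : ∀ {u} → Reach (D Jt) u v → Justified J′ u → ¬ jl J′ v <∞ jl J′ u
    none-above r _ lt = <∞⇒≱∞ lt (jl-≤-Reach J′ (Reach-setNode Jt v dj α r))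

  jl<jlDJ-flip : ∀ Jt v dj α → Safe Jt → WinsUnder (H Jt) α dj → H Jt v ≢ α →
    ¬ Justified Jt v → jl Jt v ≤∞ jlDJ Jt dj → jl Jt v <∞ jlDJ Jt dj
  jl<jlDJ-flip Jt v dj α ((ww , _) , H-unjustified , Pr≤jl) wins flip njv ≤dj =
    subst (_<∞ jlDJ Jt dj) (sym jlv) Pr<jlDJ
    where
    jlv : jl Jt v ≡ fin (Pr v)
    jlv = ≤∞-antisym (jl-≤ Jt ε njv) (Pr≤jl v)

    Pr<jlDJ : fin (Pr v) <∞ jlDJ Jt dj
    Pr<jlDJ with jlDJ Jt dj in e | subst (_≤∞ jlDJ Jt dj) jlv ≤dj
    ... | ∞     | _ = fin<∞
    ... | fin p | fin≤fin Prv≤p with jlDJ-attained Jt dj e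
    ...   | x , w , dx , r , njw , refl = fin<fin (≤∧≢⇒< Prv≤p (flip ∘ Hv≡α))
      where
      open ≡-Reasoning
      Hv≡α : Pr v ≡ Pr w → H Jt v ≡ α
      Hv≡α Prv≡Prw = begin
        H Jt v          ≡⟨ H-unjustified v njv ⟩
        parity (Pr v)   ≡⟨ cong parity Prv≡Prw ⟩
        parity (Pr w)   ≡⟨ sym (H-unjustified w njw) ⟩
        H Jt w          ≡⟨ sym (H-along ww r) ⟩
        H Jt x          ≡⟨ wins x dx ⟩
        α               ∎

  flip-grows : ∀ Jt v dj α → Executable Jt v dj α → H Jt v ≢ α →
    size Jt <size size (setNode (resetAbove Jt v) v dj α)
  flip-grows Jt v dj α (safe@((ww , _) , _) , djv , wins , ≤dj , <dj) flip =
    size-grows-within Jt J′ v (SameOutside-setNode sameK) jv keep-within none-above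
    where
    K  = resetAbove Jt v
    J′ = setNode K v dj α
    sameK = SameOutside-resetAbove Jt v
    jv = setNode-justified-self K v dj α djv

    target-outside : ∀ {x} → dj x ≡ true → ¬ Reach (D Jt) x v
    target-outside dx r = flip (trans (sym (H-along ww r)) (wins _ dx))

    jl<jlDJ : jl Jt v <∞ jlDJ Jt dj
    jl<jlDJ with justified? Jt v
    ... | yes jv₀ = <dj jv₀
    ... | no njv₀ = jl<jlDJ-flip Jt v dj α safe wins flip njv₀ (≤dj njv₀)

    jlDJ≤jlDJ-reset : jlDJ Jt dj ≤∞ jlDJ K dj
    jlDJ≤jlDJ-reset = jlDJ-glb K dj λ dx →
      ≤∞-trans (jlDJ-≤ Jt dj dx) (≤∞-reflexive (sym (jl-outside sameK (target-outside dx))))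

    jl<jl′ : jl Jt v <∞ jl J′ v
    jl<jl′ = <∞-≤∞-trans jl<jlDJ (≤∞-trans jlDJ≤jlDJ-reset (jlDJ≤jl-setNode K v dj α jv))

    keep-within : ∀ {u} → Reach (D Jt) u v → Justified Jt u → jl J′ v ≤∞ jl Jt u →
      u ≢ v × Justified J′ u × jl J′ u ≡ jl Jt u
    keep-within r _ le = contradiction (≤∞-trans le (jl-≤-Reach Jt r)) (<∞⇒≱∞ jl<jl′)

    none-above : ∀ {u} → Reach (D Jt) u v → Justified J′ u → ¬ jl J′ v <∞ jl J′ u
    none-above {u} r ju lt = case u ≟ v of λ where
      (yes u≡v) → <∞-irrefl (subst (λ y → jl J′ v <∞ jl J′ y) u≡v lt)
      (no  u≢v) → resetAbove-unjustified r (trans (sym (setNode-justified-other K v dj α u≢v)) ju)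

  justify-grows : ∀ Jt v dj α → Executable Jt v dj α → size Jt <size size (Justify Jt v dj α)
  justify-grows Jt v dj α ex@(_ , djv , _ , ≤dj , <dj) = grows
    where
    grows : size Jt <size
      size (if H Jt v ==P α then setNode Jt v dj α else setNode (resetAbove Jt v) v dj α)
    grows with H Jt v ==P α in e
    ... | true  = setNode-grows Jt v dj α djv ≤dj <dj
    ... | false = flip-grows Jt v dj α ex (==P⇒≢ e)

lemma3 : (G : ParityGame) → let open Game G in
    (Jt : J) (v : V) (dj : V → Bool) (α : Player) →
    IsJustification Jt → Executable Jt v dj α →
    size Jt <size size (Justify Jt v dj α)
lemma3 G Jt v dj α _ = justify-grows G Jt v dj α
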